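{- Let $V$ be the permutation of $C(n)$ defined as follows: given $c\in C(n)$, append a final part $0$ if $c$ has odd length, so $c=(c_1,\ldots,c_{2u})$; replace each pair $(c_{2i-1},c_{2i})$ by $(1^{c_{2i-1}-c_{2i}},2c_{2i})$ (omitting a part $0$) if $c_{2i}-c_{2i-1}<1$, and by $(1^{c_{2i-1}+c_{2i}-2k-1},2k+1)$ if $2k-1\le c_{2i}-c_{2i-1}<2k+1$ for an integer $k\ge1$; and concatenate. Then the set $C^V(n)$ of compositions $c\in C(n)$ with $V(c)=c$ consists exactly of the compositions $c=(c_1,\ldots,c_t)\in C(n)$ such that $c_{2i-1}=1$ for every $i$ with $2i-1\le t$ and $c_{2i}$ is odd and at least $3$ for every $i$ with $2i\le t$. Moreover, $c^V(n)=|C^V(n)|$ satisfies $c^V(n)=c^V(n-2)+c^V(n-4)$ for $n\ge 5$, with $c^V(1)=c^V(4)=1$ and $c^V(2)=c^V(3)=0$.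
   Context: $C(n)$ is the set of compositions of a positive integer $n$ (finite sequences of positive integers summing to $n$). $1^m$ denotes $m$ consecutive parts equal to $1$ (nothing if $m=0$). -}

module Defs where

open import Data.Nat using (ℕ; zero; suc; _+_; _*_; _∸_; _≤_; _<_; _≤?_; ⌊_/2⌋; _%_)
open import Data.List using (List; []; _∷_; _++_; [_]; replicate; length; lookup)
open import Data.Nat.ListAction using (sum)
open import Data.List.Relation.Unary.All using (All)
open import Data.Fin using (Fin; toℕ)
open import Data.Product using (Σ; _×_)
open import Relation.Binary.PropositionalEquality using (_≡_)
open import Relation.Nullary using (yes; no)
open import Function.Bundles using (_↔_)

IsComposition : ℕ → List ℕ → Set
IsComposition n c = All (λ x → 0 < x) c × sum c ≡ n

doublePart : ℕ → List ℕ
doublePart zero    = []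
doublePart (suc m) = [ 2 * suc m ]

-- image of the pair (a , b)
-- if b - a < 1 (i.e. b ≤ a):  1^(a-b), 2b   (omitting a part 0)
-- if 2k-1 ≤ b - a < 2k+1 (k ≥ 1), i.e. k = ⌊(b-a+1)/2⌋ :  1^(a+b-2k-1), 2k+1
Vpair : ℕ → ℕ → List ℕ
Vpair a b with b ≤? a
... | yes _ = replicate (a ∸ b) 1 ++ doublePart b
... | no  _ = replicate (a + b ∸ (2 * k + 1)) 1 ++ [ 2 * k + 1 ]
  where k = ⌊ suc (b ∸ a) /2⌋

V : List ℕ → List ℕ
V []            = []
V (a ∷ [])      = Vpair a 0
V (a ∷ b ∷ c)   = Vpair a b ++ V c

CV : ℕ → Set
CV n = Σ (List ℕ) (λ c → IsComposition n c × V c ≡ c)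

HasCard : Set → ℕ → Set
HasCard A k = Fin k ↔ A

-- characterisation: with 0-based index j (1-based index j+1),
-- odd 1-based positions carry 1, even 1-based positions carry an odd part ≥ 3.
Char : List ℕ → Set
Char c = (j : Fin (length c)) →
  (toℕ j % 2 ≡ 0 → lookup c j ≡ 1) ×
  (toℕ j % 2 ≡ 1 → (lookup c j % 2 ≡ 1 × 3 ≤ lookup c j))

{-# OPTIONS --safe #-}
-- If b > 0, the pair (a , b) is reproduced by V only when a = 1 and b is odd and at least 3:
-- for b ≤ a the image is a run of 1s followed by 2b, which cannot start with a , b; otherwise
-- it is a run of a + b - (2k+1) ones followed by 2k+1, and matching a , b forces the run to
-- have length exactly 1.  Hence the fixed points are 1, b₁, 1, b₂, … (possibly ending in 1)
-- with every bᵢ odd and ≥ 3.  Deleting a leading pair (1, 3), or lowering a leading (1, b)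
-- with b ≥ 5 to (1, b - 2), identifies the fixed points of n with the disjoint union of
-- those of n - 4 and those of n - 2.
module Submission where

open import Defs
open import Data.Nat using (ℕ; zero; suc; _+_; _*_; _∸_; _≤_; _<_; _≤?_; ⌊_/2⌋; _%_; z≤n; s≤s)
open import Data.Nat.Properties using (_≟_; ≡-irrelevant; <-irrelevant; ≤-antisym; ≤-trans; m≤n⇒m≤o+n; m∸n≡0⇒m≤n; m+1+n≢m; 0≢1+n; m+n∸m≡n; m+n∸n≡m; +-suc)
open import Data.Nat.ListAction using (sum)
open import Data.List using (List; []; _∷_; _++_; [_]; replicate)
open import Data.List.Properties using (∷-injective; ∷-injectiveˡ; ++-assoc; ≡-dec)
open import Data.List.Relation.Unary.All as All using (All; []; _∷_)
open import Data.Fin using (zero; suc)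
open import Data.Fin.Properties using (0↔⊥; 1↔⊤; +↔⊎)
open import Data.Product using (Σ; _×_; _,_; proj₁; proj₂)
open import Data.Sum using (_⊎_; inj₁; inj₂)
open import Data.Sum.Function.Propositional using (_⊎-↔_)
open import Data.Unit using (⊤; tt)
open import Data.Empty using (⊥; ⊥-elim)
open import Relation.Nullary using (¬_; yes; no; contradiction)
open import Relation.Binary.PropositionalEquality using (_≡_; _≢_; refl; sym; trans; cong; cong₂; subst; module ≡-Reasoning)
open import Function.Bundles using (_⇔_; mk⇔; _↔_; mk↔ₛ′)
open import Function.Properties.Inverse using (↔-sym; ↔-trans)
open import Axiom.UniquenessOfIdentityProofs using (module Decidable⇒UIP)

data Odd≥3 : ℕ → Set where
  3-odd  : Odd≥3 3
  2+-odd : ∀ {b} → Odd≥3 b → Odd≥3 (2 + b)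

Odd≥3-irrelevant : ∀ {b} (p q : Odd≥3 b) → p ≡ q
Odd≥3-irrelevant 3-odd      3-odd      = refl
Odd≥3-irrelevant 3-odd      (2+-odd ())
Odd≥3-irrelevant (2+-odd ()) 3-odd
Odd≥3-irrelevant (2+-odd p) (2+-odd q) = cong 2+-odd (Odd≥3-irrelevant p q)

Odd≥3⇒odd : ∀ {b} → Odd≥3 b → b % 2 ≡ 1
Odd≥3⇒odd 3-odd      = refl
Odd≥3⇒odd (2+-odd o) = Odd≥3⇒odd o

Odd≥3⇒3≤ : ∀ {b} → Odd≥3 b → 3 ≤ b
Odd≥3⇒3≤ 3-odd      = s≤s (s≤s (s≤s z≤n))
Odd≥3⇒3≤ (2+-odd o) = m≤n⇒m≤o+n 2 (Odd≥3⇒3≤ o)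

odd∧3≤⇒Odd≥3 : ∀ b → b % 2 ≡ 1 → 3 ≤ b → Odd≥3 b
odd∧3≤⇒Odd≥3 (suc zero)                      _ (s≤s ())
odd∧3≤⇒Odd≥3 (suc (suc (suc zero)))          _ _ = 3-odd
odd∧3≤⇒Odd≥3 (suc (suc (suc (suc zero))))    () _
odd∧3≤⇒Odd≥3 (suc (suc b@(suc (suc (suc _))))) o _ =
  2+-odd (odd∧3≤⇒Odd≥3 b o (s≤s (s≤s (s≤s z≤n))))

2[1+k]+1≡2+[2k+1] : ∀ k → 2 * suc k + 1 ≡ 2 + (2 * k + 1)
2[1+k]+1≡2+[2k+1] k = cong (λ x → suc (x + 1)) (+-suc k (k + 0))

Odd≥3-2[1+k]+1 : ∀ k → Odd≥3 (2 * suc k + 1)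
Odd≥3-2[1+k]+1 zero    = 3-odd
Odd≥3-2[1+k]+1 (suc k) =
  subst Odd≥3 (sym (2[1+k]+1≡2+[2k+1] (suc k))) (2+-odd (Odd≥3-2[1+k]+1 k))

2k+1⇒Odd≥3 : ∀ k {b} → b ≡ 2 * k + 1 → ¬ b ≤ 1 → Odd≥3 b
2k+1⇒Odd≥3 zero    refl b≰1 = contradiction (s≤s z≤n) b≰1
2k+1⇒Odd≥3 (suc k) refl _   = Odd≥3-2[1+k]+1 k

Odd≥3⇒2⌊b/2⌋+1≡b : ∀ {b} → Odd≥3 b → 2 * ⌊ b /2⌋ + 1 ≡ b
Odd≥3⇒2⌊b/2⌋+1≡b 3-odd              = refl
Odd≥3⇒2⌊b/2⌋+1≡b (2+-odd {b} o) =
  trans (2[1+k]+1≡2+[2k+1] ⌊ b /2⌋) (cong (2 +_) (Odd≥3⇒2⌊b/2⌋+1≡b o))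

Vpair-1-odd : ∀ {b} → Odd≥3 b → Vpair 1 b ≡ 1 ∷ b ∷ []
Vpair-1-odd 3-odd = refl
Vpair-1-odd (2+-odd {b} o) = begin
  replicate (3 + b ∸ t) 1 ++ [ t ]      ≡⟨ cong (λ t → replicate (3 + b ∸ t) 1 ++ [ t ]) t≡2+b ⟩
  replicate (1 + b ∸ b) 1 ++ [ 2 + b ]  ≡⟨ cong (λ m → replicate m 1 ++ [ 2 + b ]) (m+n∸n≡m 1 b) ⟩
  1 ∷ 2 + b ∷ []                        ∎
  where
  open ≡-Reasoning
  t = 2 * ⌊ 2 + b /2⌋ + 1
  t≡2+b : t ≡ 2 + b
  t≡2+b = Odd≥3⇒2⌊b/2⌋+1≡b (2+-odd o)

doubling-not-fixed : ∀ {a b r s} m → 0 < b → b ≤ a → a ∸ b ≡ m →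
                     replicate m 1 ++ doublePart b ++ r ≢ a ∷ b ∷ s
doubling-not-fixed {b = suc b} zero _ b≤a a∸b≡0 eq =
  m+1+n≢m (suc b) (trans (∷-injectiveˡ eq) (≤-antisym (m∸n≡0⇒m≤n a∸b≡0) b≤a))
doubling-not-fixed (suc m) (s≤s z≤n) b≤a a∸b≡1+m eq with ∷-injectiveˡ eq | b≤a
... | refl | s≤s z≤n = 0≢1+n a∸b≡1+m

ones-then-odd : ∀ {a b t r s} m → ¬ b ≤ a → a + b ∸ t ≡ m →
                replicate m 1 ++ t ∷ r ≡ a ∷ b ∷ s → a ≡ 1 × b ≡ t × r ≡ s
ones-then-odd {b = b} {t} zero b≰a a+b∸t≡0 eq with ∷-injectiveˡ eq
... | refl with trans (sym (m+n∸m≡n t b)) a+b∸t≡0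
...   | refl = contradiction z≤n b≰a
ones-then-odd (suc zero) _ _ eq with ∷-injective eq
... | refl , eq′ with ∷-injective eq′
...   | refl , r≡s = refl , refl , r≡s
ones-then-odd (suc (suc m)) b≰a _ eq with ∷-injective eq
... | refl , eq′ with ∷-injectiveˡ eq′
...   | refl = contradiction (s≤s z≤n) b≰a

Vpair-fixed : ∀ {a b r s} → 0 < b → Vpair a b ++ r ≡ a ∷ b ∷ s → a ≡ 1 × Odd≥3 b × r ≡ s
Vpair-fixed {a} {b} {r} 0<b eq with b ≤? a
... | yes b≤a = ⊥-elim (doubling-not-fixed _ 0<b b≤a refl
                  (trans (sym (++-assoc (replicate (a ∸ b) 1) (doublePart b) r)) eq))
... | no b≰a with ones-then-odd {t = 2 * ⌊ suc (b ∸ a) /2⌋ + 1} _ b≰a refl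
                    (trans (sym (++-assoc (replicate _ 1) [ _ ] r)) eq)
...   | refl , b≡t , r≡s = refl , 2k+1⇒Odd≥3 ⌊ suc (b ∸ 1) /2⌋ b≡t b≰a , r≡s

data FixedShape : List ℕ → Set where
  []    : FixedShape []
  [1]   : FixedShape [ 1 ]
  1∷_∷_ : ∀ {b c} → Odd≥3 b → FixedShape c → FixedShape (1 ∷ b ∷ c)

FixedShape-irrelevant : ∀ {c} (p q : FixedShape c) → p ≡ q
FixedShape-irrelevant []         []         = refl
FixedShape-irrelevant [1]        [1]        = refl
FixedShape-irrelevant (1∷ o ∷ p) (1∷ o′ ∷ q) =
  cong₂ 1∷_∷_ (Odd≥3-irrelevant o o′) (FixedShape-irrelevant p q)

FixedShape⇒positive : ∀ {c} → FixedShape c → All (0 <_) c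
FixedShape⇒positive []         = []
FixedShape⇒positive [1]        = s≤s z≤n ∷ []
FixedShape⇒positive (1∷ o ∷ p) = s≤s z≤n ∷ ≤-trans (s≤s z≤n) (Odd≥3⇒3≤ o) ∷ FixedShape⇒positive p

FixedShape⇒V-fixed : ∀ {c} → FixedShape c → V c ≡ c
FixedShape⇒V-fixed []         = refl
FixedShape⇒V-fixed [1]        = refl
FixedShape⇒V-fixed (1∷ o ∷ p) = cong₂ _++_ (Vpair-1-odd o) (FixedShape⇒V-fixed p)

V-fixed⇒FixedShape : ∀ {c} → All (0 <_) c → V c ≡ c → FixedShape c
V-fixed⇒FixedShape {[]}         _ _  = []
V-fixed⇒FixedShape {suc a ∷ []} _ eq with ∷-injectiveˡ eq
... | refl = [1]
V-fixed⇒FixedShape {a ∷ b ∷ c} (_ ∷ 0<b ∷ pos) eq with Vpair-fixed 0<b eq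
... | refl , o , Vc≡c = 1∷ o ∷ V-fixed⇒FixedShape pos Vc≡c

FixedShape⇒Char : ∀ {c} → FixedShape c → Char c
FixedShape⇒Char [1]        zero          = (λ _ → refl) , λ ()
FixedShape⇒Char (1∷ o ∷ p) zero          = (λ _ → refl) , λ ()
FixedShape⇒Char (1∷ o ∷ p) (suc zero)    = (λ ()) , λ _ → Odd≥3⇒odd o , Odd≥3⇒3≤ o
FixedShape⇒Char (1∷ o ∷ p) (suc (suc j)) = FixedShape⇒Char p j

Char⇒FixedShape : ∀ c → Char c → FixedShape c
Char⇒FixedShape []          _  = []
Char⇒FixedShape (a ∷ [])    ch with proj₁ (ch zero) refl
... | refl = [1]
Char⇒FixedShape (a ∷ b ∷ c) ch with proj₁ (ch zero) refl | proj₂ (ch (suc zero)) refl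
... | refl | b-odd , 3≤b =
  1∷ odd∧3≤⇒Odd≥3 b b-odd 3≤b ∷ Char⇒FixedShape c (λ j → ch (suc (suc j)))

V-fixed⇔Char : ∀ {c} → All (0 <_) c → (V c ≡ c ⇔ Char c)
V-fixed⇔Char {c} pos = mk⇔
  (λ fixed → FixedShape⇒Char (V-fixed⇒FixedShape pos fixed))
  (λ ch → FixedShape⇒V-fixed (Char⇒FixedShape c ch))

FixedShapes : ℕ → Set
FixedShapes n = Σ (List ℕ) (λ c → FixedShape c × sum c ≡ n)

FixedShapes-≡ : ∀ {n} {x y : FixedShapes n} → proj₁ x ≡ proj₁ y → x ≡ y
FixedShapes-≡ {x = c , p , e} {.c , q , f} refl =
  cong₂ (λ p e → c , p , e) (FixedShape-irrelevant p q) (≡-irrelevant e f)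

CV-≡ : ∀ {n} {x y : CV n} → proj₁ x ≡ proj₁ y → x ≡ y
CV-≡ {x = c , (pos , e) , fixed} {.c , (pos′ , e′) , fixed′} refl
  rewrite All.irrelevant <-irrelevant pos pos′
        | ≡-irrelevant e e′
        | Decidable⇒UIP.≡-irrelevant (≡-dec _≟_) fixed fixed′ = refl

CV↔FixedShapes : ∀ n → CV n ↔ FixedShapes n
CV↔FixedShapes n = mk↔ₛ′ to from (λ _ → FixedShapes-≡ refl) (λ _ → CV-≡ refl)
  where
  to : CV n → FixedShapes n
  to (c , (pos , e) , fixed) = c , V-fixed⇒FixedShape pos fixed , e
  from : FixedShapes n → CV n
  from (c , p , e) = c , (FixedShape⇒positive p , e) , FixedShape⇒V-fixed p

FixedShapes-recurrence : ∀ m → FixedShapes (5 + m) ↔ (FixedShapes (3 + m) ⊎ FixedShapes (1 + m))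
FixedShapes-recurrence m = mk↔ₛ′ shrink grow shrink∘grow grow∘shrink
  where
  shrink : FixedShapes (5 + m) → FixedShapes (3 + m) ⊎ FixedShapes (1 + m)
  shrink (1 ∷ _ ∷ c , 1∷ 3-odd ∷ p , e)        = inj₂ (c , p , cong (_∸ 4) e)
  shrink (1 ∷ _ ∷ c , 1∷ 2+-odd {b} o ∷ p , e) = inj₁ (1 ∷ b ∷ c , 1∷ o ∷ p , cong (_∸ 2) e)

  grow : FixedShapes (3 + m) ⊎ FixedShapes (1 + m) → FixedShapes (5 + m)
  grow (inj₁ (1 ∷ b ∷ c , 1∷ o ∷ p , e)) = 1 ∷ (2 + b) ∷ c , 1∷ 2+-odd o ∷ p , cong (2 +_) e
  grow (inj₂ (c , p , e))                = 1 ∷ 3 ∷ c , 1∷ 3-odd ∷ p , cong (4 +_) e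

  shrink∘grow : ∀ y → shrink (grow y) ≡ y
  shrink∘grow (inj₁ (_ , 1∷ _ ∷ _ , _)) = cong inj₁ (FixedShapes-≡ refl)
  shrink∘grow (inj₂ _)                  = cong inj₂ (FixedShapes-≡ refl)

  grow∘shrink : ∀ x → grow (shrink x) ≡ x
  grow∘shrink (_ , 1∷ 3-odd ∷ _ , _)    = FixedShapes-≡ refl
  grow∘shrink (_ , 1∷ 2+-odd _ ∷ _ , _) = FixedShapes-≡ refl

HasCard-fromShapes : ∀ {n k} → HasCard (FixedShapes n) k → HasCard (CV n) k
HasCard-fromShapes h = ↔-trans h (↔-sym (CV↔FixedShapes _))

HasCard-toShapes : ∀ {n k} → HasCard (CV n) k → HasCard (FixedShapes n) k
HasCard-toShapes h = ↔-trans h (CV↔FixedShapes _)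

CV-recurrence : (n a b : ℕ) → 5 ≤ n → HasCard (CV (n ∸ 2)) a → HasCard (CV (n ∸ 4)) b →
                HasCard (CV n) (a + b)
CV-recurrence (suc (suc (suc (suc (suc m))))) a b (s≤s (s≤s (s≤s (s≤s (s≤s _))))) ha hb =
  HasCard-fromShapes (↔-trans +↔⊎ (↔-trans
    (HasCard-toShapes ha ⊎-↔ HasCard-toShapes hb) (↔-sym (FixedShapes-recurrence m))))

singleton-HasCard : ∀ {A : Set} (x : A) → (∀ y → x ≡ y) → HasCard A 1
singleton-HasCard x unique = ↔-trans 1↔⊤ (mk↔ₛ′ (λ _ → x) (λ _ → tt) unique (λ _ → refl))

empty-HasCard : ∀ {A : Set} → ¬ A → HasCard A 0
empty-HasCard ¬A = ↔-trans 0↔⊥ (mk↔ₛ′ ⊥-elim ¬A (λ a → contradiction a ¬A) (λ ()))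

FixedShapes-1 : HasCard (FixedShapes 1) 1
FixedShapes-1 = singleton-HasCard ([ 1 ] , [1] , refl) λ y → FixedShapes-≡ (sym (unique y))
  where
  unique : (y : FixedShapes 1) → proj₁ y ≡ [ 1 ]
  unique (_ , [1] , _) = refl
  unique (_ , 1∷ 3-odd ∷ _ , ())
  unique (_ , 1∷ 2+-odd _ ∷ _ , ())

FixedShapes-4 : HasCard (FixedShapes 4) 1
FixedShapes-4 =
  singleton-HasCard (1 ∷ 3 ∷ [] , 1∷ 3-odd ∷ [] , refl) λ y → FixedShapes-≡ (sym (unique y))
  where
  unique : (y : FixedShapes 4) → proj₁ y ≡ 1 ∷ 3 ∷ []
  unique (_ , 1∷ 3-odd ∷ [] , _) = refl
  unique (_ , 1∷ 3-odd ∷ [1] , ())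
  unique (_ , 1∷ 3-odd ∷ 1∷ _ ∷ _ , ())
  unique (_ , 1∷ 2+-odd 3-odd ∷ _ , ())
  unique (_ , 1∷ 2+-odd (2+-odd _) ∷ _ , ())

¬FixedShapes-2 : ¬ FixedShapes 2
¬FixedShapes-2 (_ , 1∷ 3-odd ∷ _ , ())
¬FixedShapes-2 (_ , 1∷ 2+-odd _ ∷ _ , ())

¬FixedShapes-3 : ¬ FixedShapes 3
¬FixedShapes-3 (_ , 1∷ 3-odd ∷ _ , ())
¬FixedShapes-3 (_ , 1∷ 2+-odd 3-odd ∷ _ , ())
¬FixedShapes-3 (_ , 1∷ 2+-odd (2+-odd _) ∷ _ , ())

proposition3p5 :
    ((n : ℕ) (c : List ℕ) → IsComposition n c → (V c ≡ c ⇔ Char c))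
    × ((n a b : ℕ) → 5 ≤ n → HasCard (CV (n ∸ 2)) a → HasCard (CV (n ∸ 4)) b
        → HasCard (CV n) (a + b))
    × HasCard (CV 1) 1 × HasCard (CV 4) 1 × HasCard (CV 2) 0 × HasCard (CV 3) 0
proposition3p5 =
  (λ _ _ (pos , _) → V-fixed⇔Char pos) ,
  CV-recurrence ,
  HasCard-fromShapes FixedShapes-1 ,
  HasCard-fromShapes FixedShapes-4 ,
  HasCard-fromShapes (empty-HasCard ¬FixedShapes-2) ,
  HasCard-fromShapes (empty-HasCard ¬FixedShapes-3)
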